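{- Let $n = p_1^{a_1} p_2^{a_2} \cdots p_k^{a_k}$ where $p_1 < p_2 < \cdots < p_k$ are primes and $a_i \ge 1$. Suppose that $a_i = 1$ for some $i$ with $1 \le i < k$. Then $n$ satisfies the radical inequality.
   Context: For a positive integer $n$ with exactly $k$ distinct prime factors, let $R(n)$ be the product of the distinct primes dividing $n$. We say $n$ satisfies the radical inequality if there exist a prime $p$ and an integer $a \ge 1$ with $p^a \| n$ (i.e. $p^a \mid n$, $p^{a+1} \nmid n$) and $p^{a+1} < k R(n)$. -}

module Defs where

open import Data.Nat using (ℕ; suc; _*_; _^_; _<_; _≥_)
open import Data.Nat.Divisibility using (_∣_; _∣?_)
open import Data.Nat.Primality using (Prime; prime?)
open import Data.List using (List; filter; upTo; length)
open import Data.Nat.ListAction using (product)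
open import Data.Product using (Σ; _×_)
open import Relation.Nullary using (¬_)
open import Relation.Nullary.Decidable using (_×-dec_)

-- The distinct primes dividing n (for n ≥ 1 all such primes are ≤ n),
-- listed in increasing order.
primeDivisors : ℕ → List ℕ
primeDivisors n = filter (λ p → prime? p ×-dec (p ∣? n)) (upTo (suc n))

ω : ℕ → ℕ
ω n = length (primeDivisors n)

R : ℕ → ℕ
R n = product (primeDivisors n)

_^_∥_ : ℕ → ℕ → ℕ → Set
p ^ a ∥ n = (p ^ a ∣ n) × ¬ (p ^ suc a ∣ n)

-- n satisfies the radical inequality (with k = ω(n))
RadicalInequality : ℕ → Set
RadicalInequality n =
  Σ ℕ λ p → Σ ℕ λ a → Prime p × a ≥ 1 × (p ^ a ∥ n) × (p ^ suc a < ω n * R n)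

module Submission where

-- Let q = p_i be the prime occurring to the first power and
-- r = p_{i+1} the next prime of the factorisation, so q < r.  Then q ∥ n,
-- and since q and r are distinct primes dividing the radical R(n), their
-- product is at most R(n); hence
--     q² < q·r ≤ R(n) ≤ ω(n)·R(n),
-- which is the radical inequality witnessed by q with exponent 1.

open import Defs
open import Data.Nat using (ℕ; zero; suc; _*_; _^_; _<_; _≤_; _≥_; NonZero; z≤n; s≤s)
open import Data.Nat.Properties
  using (≤-reflexive; *-identityʳ; *-identityˡ; *-monoʳ-<; *-monoˡ-≤; <⇒≢; <-cmp; m*n≢0⇒m≢0; *-commutativeSemigroup; module ≤-Reasoning)
open import Data.Nat.Divisibility
  using (_∣_; _∣?_; divides; ∣-trans; m∣m*n; ∣1⇒≡1; ∣⇒≤; _∣0; *-cancelˡ-∣)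
open import Data.Nat.Primality
  using (Prime; prime?; euclidsLemma; prime⇒irreducible; prime⇒nonZero; ¬prime[1]; productOfPrimes≢0)
open import Data.Nat.ListAction using (product)
open import Data.Nat.ListAction.Properties using (∈⇒∣product)
open import Algebra.Properties.CommutativeSemigroup *-commutativeSemigroup using (x∙yz≈y∙xz)
open import Data.Fin using (Fin; toℕ; fromℕ<; punchIn) renaming (zero to fzero; suc to fsuc)
open import Data.Fin.Properties using (toℕ-fromℕ<; toℕ-injective; punchInᵢ≢i)
open import Data.Vec.Functional using (toList; removeAt)
open import Data.List using (List; _∷_; length; upTo)
open import Data.List.Membership.Propositional using (_∈_)
open import Data.List.Membership.Propositional.Properties using (∈-filter⁺; ∈-upTo⁺)
open import Data.List.Relation.Unary.All using () renaming (map to mapAll)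
open import Data.List.Relation.Unary.All.Properties using (all-filter)
open import Data.Product using (Σ; _×_; _,_; proj₁)
open import Data.Sum using (inj₁; inj₂)
open import Relation.Binary using (tri<; tri≈; tri>)
open import Relation.Binary.PropositionalEquality using (_≡_; _≢_; refl; sym; trans; cong; subst; module ≡-Reasoning)
open import Relation.Nullary using (¬_; Dec; contradiction)
open import Relation.Nullary.Decidable using (_×-dec_)

prime∣prime⇒≡ : ∀ {p q} → Prime p → Prime q → p ∣ q → p ≡ q
prime∣prime⇒≡ pp pq p∣q with prime⇒irreducible pq p∣q
... | inj₁ p≡1 = contradiction (subst Prime p≡1 pp) ¬prime[1]
... | inj₂ p≡q = p≡q

prime∤1 : ∀ {p} → Prime p → ¬ p ∣ 1
prime∤1 pp p∣1 = ¬prime[1] (subst Prime (∣1⇒≡1 p∣1) pp)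

prime∣^⇒∣ : ∀ {p} m a → Prime p → p ∣ m ^ a → p ∣ m
prime∣^⇒∣ m zero    pp p∣1 = contradiction p∣1 (prime∤1 pp)
prime∣^⇒∣ m (suc a) pp p∣m^1+a with euclidsLemma m (m ^ a) pp p∣m^1+a
... | inj₁ p∣m   = p∣m
... | inj₂ p∣m^a = prime∣^⇒∣ m a pp p∣m^a

∣^ : ∀ m {a} → a ≥ 1 → m ∣ m ^ a
∣^ m {suc a} _ = m∣m*n (m ^ a)

prime∤product : ∀ {p k} (f : Fin k → ℕ) → Prime p → (∀ j → ¬ p ∣ f j) → ¬ p ∣ product (toList f)
prime∤product {k = zero}  f pp p∤f p∣1 = prime∤1 pp p∣1
prime∤product {k = suc k} f pp p∤f p∣prod with euclidsLemma (f fzero) _ pp p∣prod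
... | inj₁ p∣head = p∤f fzero p∣head
... | inj₂ p∣tail = prime∤product (λ j → f (fsuc j)) pp (λ j → p∤f (fsuc j)) p∣tail

product-removeAt : ∀ {k} (f : Fin (suc k) → ℕ) (i : Fin (suc k)) →
  product (toList f) ≡ f i * product (toList (removeAt f i))
product-removeAt         f fzero    = refl
product-removeAt {suc k} f (fsuc i) = begin
  f fzero * product (toList (λ j → f (fsuc j)))
    ≡⟨ cong (f fzero *_) (product-removeAt (λ j → f (fsuc j)) i) ⟩
  f fzero * (f (fsuc i) * product (toList (removeAt (λ j → f (fsuc j)) i)))
    ≡⟨ x∙yz≈y∙xz (f fzero) (f (fsuc i)) _ ⟩
  f (fsuc i) * product (toList (removeAt f (fsuc i)))  ∎
  where open ≡-Reasoning

factor∣product : ∀ {k} (f : Fin (suc k) → ℕ) (i : Fin (suc k)) → f i ∣ product (toList f)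
factor∣product f i = subst (f i ∣_) (sym (product-removeAt f i)) (m∣m*n _)

prime∥product : ∀ {q k} (f : Fin (suc k) → ℕ) (i : Fin (suc k)) → Prime q → f i ≡ q →
  (∀ j → ¬ q ∣ removeAt f i j) → q ^ 1 ∥ product (toList f)
prime∥product {q} f i pq fi≡q q∤others =
  subst (_∣ product (toList f)) q≡q^1 (subst (_∣ _) fi≡q (factor∣product f i)) , q²∤n
  where
  instance
    q≢0 : NonZero q
    q≢0 = prime⇒nonZero pq
  rest : ℕ
  rest = product (toList (removeAt f i))
  q≡q^1 : q ≡ q ^ 1
  q≡q^1 = sym (*-identityʳ q)
  n≡q*rest : product (toList f) ≡ q * rest
  n≡q*rest = trans (product-removeAt f i) (cong (_* rest) fi≡q)
  q²∤n : ¬ q ^ 2 ∣ product (toList f)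
  q²∤n q²∣n = prime∤product (removeAt f i) pq q∤others
    (*-cancelˡ-∣ q (subst (q * q ∣_) n≡q*rest (subst (λ x → q * x ∣ _) (sym q≡q^1) q²∣n)))

∥⇒nonZero : ∀ {p a n} → p ^ a ∥ n → NonZero n
∥⇒nonZero {n = zero}  (_ , p^1+a∤0) = contradiction (_ ∣0) p^1+a∤0
∥⇒nonZero {n = suc n} _             = _

distinctPrimes*≤ : ∀ {p q m} {{_ : NonZero m}} → Prime p → Prime q → p ≢ q →
  p ∣ m → q ∣ m → p * q ≤ m
distinctPrimes*≤ {p} {q} {m} {{m≢0}} pp pq p≢q p∣m (divides c m≡c*q)
  with euclidsLemma c q pp (subst (p ∣_) m≡c*q p∣m)
... | inj₂ p∣q = contradiction (prime∣prime⇒≡ pp pq p∣q) p≢q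
... | inj₁ p∣c = subst (p * q ≤_) (sym m≡c*q) (*-monoˡ-≤ q (∣⇒≤ p∣c))
  where
  instance
    c≢0 : NonZero c
    c≢0 = m*n≢0⇒m≢0 c {q} {{subst NonZero m≡c*q m≢0}}

isPrimeDivisor? : (n p : ℕ) → Dec (Prime p × p ∣ n)
isPrimeDivisor? n p = prime? p ×-dec (p ∣? n)

∈primeDivisors : ∀ {p n} {{_ : NonZero n}} → Prime p → p ∣ n → p ∈ primeDivisors n
∈primeDivisors {n = n} pp p∣n = ∈-filter⁺ (isPrimeDivisor? n) (∈-upTo⁺ (s≤s (∣⇒≤ p∣n))) (pp , p∣n)

R-nonZero : ∀ n → NonZero (R n)
R-nonZero n = productOfPrimes≢0 (mapAll proj₁ (all-filter (isPrimeDivisor? n) (upTo (suc n))))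

∈⇒length≥1 : ∀ {x : ℕ} {xs : List ℕ} → x ∈ xs → length xs ≥ 1
∈⇒length≥1 {xs = _ ∷ _} _ = s≤s z≤n

twoPrimes⇒radicalInequality : ∀ {q r n} → Prime q → Prime r → q < r →
  q ^ 1 ∥ n → r ∣ n → RadicalInequality n
twoPrimes⇒radicalInequality {q} {r} {n} pq pr q<r q∥n r∣n =
  q , 1 , pq , s≤s z≤n , q∥n , bound
  where
  instance
    n≢0 : NonZero n
    n≢0 = ∥⇒nonZero {q} {1} q∥n
    q≢0 : NonZero q
    q≢0 = prime⇒nonZero pq
    R≢0 : NonZero (R n)
    R≢0 = R-nonZero n
  q∣n : q ∣ n
  q∣n = ∣-trans (m∣m*n {q} 1) (proj₁ q∥n)
  q∈ : q ∈ primeDivisors n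
  q∈ = ∈primeDivisors pq q∣n
  qr≤R : q * r ≤ R n
  qr≤R = distinctPrimes*≤ pq pr (<⇒≢ q<r) (∈⇒∣product q∈) (∈⇒∣product (∈primeDivisors pr r∣n))
  bound : q ^ 2 < ω n * R n
  bound = begin-strict
    q * (q * 1)  ≡⟨ cong (q *_) (*-identityʳ q) ⟩
    q * q        <⟨ *-monoʳ-< q q<r ⟩
    q * r        ≤⟨ qr≤R ⟩
    R n          ≡⟨ *-identityˡ (R n) ⟨
    1 * R n      ≤⟨ *-monoˡ-≤ (R n) (∈⇒length≥1 q∈) ⟩
    ω n * R n    ∎
    where open ≤-Reasoning

strictlyIncreasing⇒injective : ∀ {k} (p : Fin k → ℕ) →
  (∀ i j → toℕ i < toℕ j → p i < p j) → ∀ {i j} → p i ≡ p j → i ≡ j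
strictlyIncreasing⇒injective p increasing {i} {j} pi≡pj with <-cmp (toℕ i) (toℕ j)
... | tri< i<j _ _ = contradiction pi≡pj (<⇒≢ (increasing i j i<j))
... | tri≈ _ i≡j _ = toℕ-injective i≡j
... | tri> _ _ j<i = contradiction (sym pi≡pj) (<⇒≢ (increasing j i j<i))

mainTheorem6 : (k : ℕ) (p a : Fin k → ℕ) (n : ℕ)
    → (∀ i → Prime (p i))
    → (∀ i j → toℕ i < toℕ j → p i < p j)
    → (∀ i → a i ≥ 1)
    → n ≡ product (toList (λ i → p i ^ a i))
    → Σ (Fin k) (λ i → (suc (toℕ i) < k) × (a i ≡ 1))
    → RadicalInequality n
mainTheorem6 zero    _ _ _ _     _          _   _    (() , _)
mainTheorem6 (suc k) p a n prime increasing a≥1 refl (i , i+1<k , aᵢ≡1) =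
  twoPrimes⇒radicalInequality (prime i) (prime j) (increasing i j i<j)
    (prime∥product factor i (prime i) factorᵢ≡pᵢ pᵢ∤others)
    (∣-trans (∣^ (p j) (a≥1 j)) (factor∣product factor j))
  where
  factor : Fin (suc k) → ℕ
  factor l = p l ^ a l
  j : Fin (suc k)
  j = fromℕ< i+1<k
  i<j : toℕ i < toℕ j
  i<j = ≤-reflexive (sym (toℕ-fromℕ< i+1<k))
  factorᵢ≡pᵢ : factor i ≡ p i
  factorᵢ≡pᵢ = trans (cong (p i ^_) aᵢ≡1) (*-identityʳ (p i))
  -- pᵢ divides no other prime power, as the primes are pairwise distinct
  pᵢ∤others : ∀ l → ¬ p i ∣ removeAt factor i l
  pᵢ∤others l pᵢ∣factor = punchInᵢ≢i i l (sym (strictlyIncreasing⇒injective p increasing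
    (prime∣prime⇒≡ (prime i) (prime _) (prime∣^⇒∣ (p (punchIn i l)) (a (punchIn i l)) (prime i) pᵢ∣factor))))
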